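{- Let $1\le k\le n$. (a) For every matching $\tau:I\to J$ in $\mathcal M$, the orbit $\mathcal G\cdot\tau$ contains exactly $2^{p(I,J)}$ elements, where $p(I,J)=k-\operatorname{card}(I\cap J)$. (b) Each interlacing orbit contains exactly one interlacing matching.
   Context: Let $\mathcal M$ be the set of $k$-edge matchings of $K_{n,n}$ (left and right vertices each labelled $1,\dots,n$), each identified with a bijection $\tau:I\to J$ between $k$-element subsets $I,J$ of $[n]$, with edges $i\to\tau(i)$. Clusters: add an auxiliary edge $r\to r$ for each $r\in I\cap J$; components of the resulting multigraph are paths, closed (cycles, including a double edge $r\to r$) or open. Removing the auxiliary edges, the edges of $\tau$ in each component form a cluster, closed or open according to the component. Flip group: $\mathcal G$ is the direct sum of $\binom n2$ copies of $\mathbb Z/2$ indexed by pairs $i<j$ in $[n]$, with generators $f_{ij}$, acting on $\mathcal M$ by: if $\tau$ has an open cluster $C$ containing the edge $i\to j$ or $j\to i$, then $f_{ij}\cdot\tau$ replaces every edge $a\to b$ of $C$ by $b\to a$ (other edges unchanged); otherwise $f_{ij}\cdot\tau=\tau$. A matching $\tau:I\to J$ with $I=\{i_1<\dots<i_k\}$, $J=\{j_1<\dots<j_k\}$ is interlacing if $i_1\le j_1\le i_2\le j_2\le\dots\le i_k\le j_k$; an interlacing orbit is a $\mathcal G$-orbit containing an interlacing matching. -}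

module Defs where

open import Data.Nat as ℕ using (ℕ; zero; suc; _+_; _∸_)
open import Data.Fin as Fin using (Fin)
open import Data.Fin.Properties using () renaming (_≟_ to _≟ᶠ_)
open import Data.Maybe using (Maybe; just; nothing; is-just)
open import Data.Maybe.Properties using (≡-dec)
open import Data.Vec using (Vec; lookup)
open import Data.List using (List; []; _∷_; allFin; filter; map)
open import Data.Bool.ListAction using (any)
open import Data.Nat.ListAction using (sum)
open import Data.List.Relation.Unary.Linked using (Linked)
open import Data.Bool using (Bool; true; false; if_then_else_; _∧_)
open import Data.Product using (Σ; ∃; _×_; _,_)
open import Data.Sum using (_⊎_)
open import Relation.Nullary using (¬_)
open import Relation.Nullary.Decidable using (⌊_⌋; T?)
open import Relation.Binary.PropositionalEquality using (_≡_)
open import Relation.Binary.Construct.Closure.ReflexiveTransitive using (Star)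
open import Function.Bundles using (_⇔_)

-- A (partial) matching of K_{n,n}: left vertex a ↦ just b means edge a → b,
-- nothing means a ∉ I.  Vertices 1..n are represented by Fin n.
Matching : ℕ → Set
Matching n = Vec (Maybe (Fin n)) n

module _ {n : ℕ} where

  Edge : Matching n → Fin n → Fin n → Set
  Edge τ a b = lookup τ a ≡ just b

  inI : Matching n → Fin n → Bool
  inI τ r = is-just (lookup τ r)

  inJ : Matching n → Fin n → Bool
  inJ τ r = any (λ a → ⌊ ≡-dec _≟ᶠ_ (lookup τ a) (just r) ⌋) (allFin n)

  countB : (Fin n → Bool) → ℕ
  countB f = sum (map (λ r → if f r then 1 else 0) (allFin n))

  size : Matching n → ℕ
  size τ = countB (inI τ)

  cardIJ : Matching n → ℕ
  cardIJ τ = countB (λ r → inI τ r ∧ inJ τ r)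

  IsMatching : ℕ → Matching n → Set
  IsMatching k τ = (∀ a a' b → Edge τ a b → Edge τ a' b → a ≡ a') × size τ ≡ k

  p : ℕ → Matching n → ℕ
  p k τ = k ∸ cardIJ τ

  -- Clusters. Two edges (a,b),(a',b') of τ are adjacent in the multigraph
  -- (via an auxiliary edge r → r) iff the right end of one is the left end
  -- of the other.
  Adj : Matching n → (Fin n × Fin n) → (Fin n × Fin n) → Set
  Adj τ (a , b) (a' , b') = Edge τ a b × Edge τ a' b' × (b ≡ a' ⊎ b' ≡ a)

  SameCluster : Matching n → (Fin n × Fin n) → (Fin n × Fin n) → Set
  SameCluster τ = Star (Adj τ)

  -- A cluster is open (its component is a path, not a cycle) iff some vertex
  -- of its component has degree 1, i.e. some edge a → b of it has a ∉ J or b ∉ I.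
  InI InJ : Matching n → Fin n → Set
  InI τ b = ∃ λ c → Edge τ b c
  InJ τ a = ∃ λ c → Edge τ c a

  OpenAt : Matching n → (Fin n × Fin n) → Set
  OpenAt τ (a₀ , b₀) =
    Edge τ a₀ b₀ ×
    (Σ (Fin n) λ a → Σ (Fin n) λ b →
      SameCluster τ (a₀ , b₀) (a , b) × Edge τ a b × (¬ InJ τ a ⊎ ¬ InI τ b))

  OpenClusterAt : Matching n → Fin n → Fin n → (Fin n × Fin n) → Set
  OpenClusterAt τ i j e₀ = (e₀ ≡ (i , j) ⊎ e₀ ≡ (j , i)) × OpenAt τ e₀

  Flip : Matching n → Fin n → Fin n → Matching n → Set
  Flip τ i j τ' =
    (Σ (Fin n × Fin n) λ e₀ → OpenClusterAt τ i j e₀ ×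
      (∀ a b → Edge τ' a b ⇔
         ((Edge τ a b × ¬ SameCluster τ e₀ (a , b)) ⊎
          (Edge τ b a × SameCluster τ e₀ (b , a)))))
    ⊎ ((¬ Σ (Fin n × Fin n) (OpenClusterAt τ i j)) × τ' ≡ τ)

  FlipStep : Matching n → Matching n → Set
  FlipStep τ τ' = Σ (Fin n) λ i → Σ (Fin n) λ j → i Fin.< j × Flip τ i j τ'

  -- σ ∈ 𝒢 · τ  (every element of 𝒢 is a product of generators)
  InOrbit : Matching n → Matching n → Set
  InOrbit τ σ = Star FlipStep τ σ

  -- Interlacing: i₁ ≤ j₁ ≤ i₂ ≤ j₂ ≤ … ≤ i_k ≤ j_k
  interleave : {A : Set} → List A → List A → List A
  interleave [] ys = ys
  interleave (x ∷ xs) [] = x ∷ xs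
  interleave (x ∷ xs) (y ∷ ys) = x ∷ y ∷ interleave xs ys

  Ilist Jlist : Matching n → List (Fin n)
  Ilist τ = filter (λ r → T? (inI τ r)) (allFin n)
  Jlist τ = filter (λ r → T? (inJ τ r)) (allFin n)

  Interlacing : Matching n → Set
  Interlacing τ = Linked Fin._≤_ (interleave (Ilist τ) (Jlist τ))

-- Since τ is injective, its clusters are the weak components of the partial map a ↦ τ a, and each
-- open cluster is a path starting at a unique source, a vertex of I ∖ J; there are k − card (I ∩ J)
-- sources. A flip reverses one open cluster, so the orbit of τ consists of the matchings obtained by
-- reversing the open clusters of an arbitrary set of sources. The set can be read off the result (a
-- reversed source leaves I), so the orbit has 2^p elements. For (b), let σ be such a reorientation
-- with σ and τ both interlacing, and let m be the least vertex whose membership in I and in J differs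
-- between σ and τ. Then m is an end of a reversed path whose other end e > m also changes side, and
-- counting the elements of I and of J below m in the two interlacings i₁ ≤ j₁ ≤ i₂ ≤ … is contradictory.

module Submission where

open import Defs
open import Data.Nat as ℕ using (ℕ; zero; suc; _+_; _∸_; _^_; _≤_)
import Data.Nat.Properties as ℕ
open import Data.Nat.ListAction using (sum)
open import Data.Fin as Fin using (Fin; toℕ)
import Data.Fin.Properties as Fin
open import Data.Maybe using (Maybe; just; nothing; _>>=_)
open import Data.Maybe.Properties using (just-injective; ≡-dec)
open import Data.Bool using (Bool; true; false; not; _∧_; if_then_else_; T)
import Data.Bool.Properties as Bool
open import Data.Vec using (Vec; []; _∷_; lookup; replicate; tabulate; _[_]%=_)
open import Data.Vec.Properties
  using (∷-injectiveʳ; tabulate∘lookup; tabulate-cong; lookup∘tabulate; lookup∘updateAt; lookup∘updateAt′;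
         lookup-replicate)
open import Data.List as List using (List; []; _∷_; _++_; length; filter; allFin)
open import Data.List.Properties using (length-++; length-map; filter-accept; filter-reject; filter-none)
open import Data.List.Membership.Propositional using (_∈_; _∉_; lose)
open import Data.List.Membership.Propositional.Properties
  using (∈-++⁺ˡ; ∈-++⁺ʳ; ∈-map⁺; ∈-map⁻; ∈-lookup; ∈-allFin; ∈-filter⁺; ∈-filter⁻)
open import Data.List.Relation.Unary.Any as Any using (here; there; satisfied)
open import Data.List.Relation.Unary.Any.Properties using (any⁺; any⁻; lookup-index)
open import Data.List.Relation.Unary.All as All using (All; []; _∷_)
open import Data.List.Relation.Unary.AllPairs using (AllPairs; []; _∷_)
import Data.List.Relation.Unary.AllPairs.Properties as AllPairs
open import Data.List.Relation.Unary.Linked.Properties using (Linked⇒AllPairs)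
open import Data.List.Relation.Unary.Unique.Propositional using (Unique)
import Data.List.Relation.Unary.Unique.Propositional.Properties as Unique
open import Data.Product as Product using (Σ; ∃; _×_; _,_; proj₁; proj₂)
open import Data.Sum as Sum using (_⊎_; inj₁; inj₂)
open import Data.Empty using (⊥; ⊥-elim)
open import Relation.Nullary using (¬_; ¬?; Dec; yes; no; does; _×-dec_)
open import Relation.Nullary.Decidable using (T?; toWitness; fromWitness; decidable-stable)
open import Relation.Unary using (Decidable)
open import Relation.Binary using (Tri; tri<; tri≈; tri>)
open import Relation.Binary.PropositionalEquality
open import Relation.Binary.Construct.Closure.ReflexiveTransitive as Star using (Star; ε; _◅_)
open import Function.Base using (case_of_; _∘_; id)
open import Function.Bundles using (_⇔_; mk⇔; Equivalence)
open Equivalence using (to; from)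
import Function.Properties.Equivalence as ⇔

allBitVecs : ∀ m → List (Vec Bool m)
allBitVecs zero    = [] ∷ []
allBitVecs (suc m) = List.map (true ∷_) (allBitVecs m) ++ List.map (false ∷_) (allBitVecs m)

∈-allBitVecs : ∀ {m} (v : Vec Bool m) → v ∈ allBitVecs m
∈-allBitVecs []          = here refl
∈-allBitVecs (true ∷ v)  = ∈-++⁺ˡ (∈-map⁺ (true ∷_) (∈-allBitVecs v))
∈-allBitVecs (false ∷ v) = ∈-++⁺ʳ _ (∈-map⁺ (false ∷_) (∈-allBitVecs v))

allBitVecs-unique : ∀ m → Unique (allBitVecs m)
allBitVecs-unique zero    = All.[] ∷ []
allBitVecs-unique (suc m) =
  Unique.++⁺ (Unique.map⁺ ∷-injectiveʳ (allBitVecs-unique m))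
             (Unique.map⁺ ∷-injectiveʳ (allBitVecs-unique m))
             heads-differ
  where
  heads-differ : ∀ {v} → v ∈ List.map (true ∷_) (allBitVecs m) × v ∈ List.map (false ∷_) (allBitVecs m) →
                 ⊥
  heads-differ (t , f) with ∈-map⁻ (true ∷_) t | ∈-map⁻ (false ∷_) f
  ... | _ , _ , refl | _ , _ , ()

length-allBitVecs : ∀ m → length (allBitVecs m) ≡ 2 ^ m
length-allBitVecs zero    = refl
length-allBitVecs (suc m) = begin
  length (List.map (true ∷_) (allBitVecs m) ++ List.map (false ∷_) (allBitVecs m))
    ≡⟨ length-++ (List.map (true ∷_) (allBitVecs m)) ⟩
  length (List.map (true ∷_) (allBitVecs m)) + length (List.map (false ∷_) (allBitVecs m))
    ≡⟨ cong₂ _+_ (length-map (true ∷_) (allBitVecs m)) (length-map (false ∷_) (allBitVecs m)) ⟩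
  length (allBitVecs m) + length (allBitVecs m)
    ≡⟨ cong (λ l → l + l) (length-allBitVecs m) ⟩
  2 ^ m + 2 ^ m
    ≡⟨ cong (2 ^ m +_) (sym (ℕ.+-identityʳ (2 ^ m))) ⟩
  2 ^ suc m ∎
  where open ≡-Reasoning

BitFlip : ∀ {m} → Vec Bool m → Vec Bool m → Set
BitFlip u v = ∃ λ i → v ≡ u [ i ]%= not

BitFlip-∷ : ∀ {m b} {u v : Vec Bool m} → BitFlip u v → BitFlip (b ∷ u) (b ∷ v)
BitFlip-∷ (i , refl) = Fin.suc i , refl

allFalse-BitFlips : ∀ {m} (u : Vec Bool m) → Star BitFlip (replicate m false) u
allFalse-BitFlips []          = ε
allFalse-BitFlips (false ∷ u) = Star.gmap (false ∷_) BitFlip-∷ (allFalse-BitFlips u)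
allFalse-BitFlips (true ∷ u)  = (Fin.zero , refl) ◅ Star.gmap (true ∷_) BitFlip-∷ (allFalse-BitFlips u)

Unique-lookup-injective : ∀ {A : Set} {xs : List A} → Unique xs →
                          ∀ i j → List.lookup xs i ≡ List.lookup xs j → i ≡ j
Unique-lookup-injective (_  ∷ _) Fin.zero    Fin.zero    _  = refl
Unique-lookup-injective (x∉ ∷ _) Fin.zero    (Fin.suc j) eq = ⊥-elim (All.lookup x∉ (∈-lookup j) eq)
Unique-lookup-injective (x∉ ∷ _) (Fin.suc i) Fin.zero    eq = ⊥-elim (All.lookup x∉ (∈-lookup i) (sym eq))
Unique-lookup-injective (_  ∷ u) (Fin.suc i) (Fin.suc j) eq = cong Fin.suc (Unique-lookup-injective u i j eq)

Vec-ext : ∀ {A : Set} {m} {u v : Vec A m} → (∀ i → lookup u i ≡ lookup v i) → u ≡ v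
Vec-ext {u = u} {v} same = begin
  u                 ≡⟨ sym (tabulate∘lookup u) ⟩
  tabulate (lookup u) ≡⟨ tabulate-cong same ⟩
  tabulate (lookup v) ≡⟨ tabulate∘lookup v ⟩
  v                 ∎
  where open ≡-Reasoning

Matching-ext : ∀ {n} {σ σ′ : Matching n} → (∀ a b → Edge σ a b ⇔ Edge σ′ a b) → σ ≡ σ′
Matching-ext {σ = σ} {σ′} edges = Vec-ext same
  where
  same : ∀ a → lookup σ a ≡ lookup σ′ a
  same a with lookup σ a in e | lookup σ′ a in e′
  ... | just b  | _       = sym (trans (sym e′) (to (edges a b) e))
  ... | nothing | just b′ = case trans (sym e) (from (edges a b′) e′) of λ ()
  ... | nothing | nothing = refl

reflects-≡ : ∀ {b c : Bool} {P Q : Set} → T b ⇔ P → T c ⇔ Q → P ⇔ Q → b ≡ c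
reflects-≡ {false} {false} _  _  _   = refl
reflects-≡ {true}  {true}  _  _  _   = refl
reflects-≡ {false} {true}  bP cQ P⇔Q = ⊥-elim (from bP (from P⇔Q (to cQ _)))
reflects-≡ {true}  {false} bP cQ P⇔Q = ⊥-elim (from cQ (to P⇔Q (to bP _)))

reflects-⇔ : ∀ {b c : Bool} {P Q : Set} → T b ⇔ P → T c ⇔ Q → b ≡ c → P ⇔ Q
reflects-⇔ bP cQ refl = mk⇔ (to cQ ∘ from bP) (to bP ∘ from cQ)

-- count f (allFin n) is countB f, so count-split relates size, cardIJ and the number of sources.
count : ∀ {A : Set} → (A → Bool) → List A → ℕ
count f xs = sum (List.map (λ x → if f x then 1 else 0) xs)

count-split : ∀ {A : Set} (f g : A → Bool) xs →
              count f xs ≡ count (λ x → f x ∧ g x) xs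
                           + length (filter (λ x → T? (f x) ×-dec ¬? (T? (g x))) xs)
count-split f g []       = refl
count-split f g (x ∷ xs) with f x | g x
... | true  | true  = cong suc (count-split f g xs)
... | true  | false = trans (cong suc (count-split f g xs)) (sym (ℕ.+-suc _ _))
... | false | _     = count-split f g xs

T-inI : ∀ {n} (τ : Matching n) r → T (inI τ r) ⇔ InI τ r
T-inI τ r with lookup τ r
... | just b  = mk⇔ (λ _ → b , refl) _
... | nothing = mk⇔ (λ ()) (λ ())

T-inJ : ∀ {n} (τ : Matching n) r → T (inJ τ r) ⇔ InJ τ r
T-inJ {n} τ r = mk⇔
  (λ t → let (a , a→r) = satisfied (any⁻ _ (allFin n) t) in a , toWitness a→r)
  (λ (a , a→r) → any⁺ _ (lose (∈-allFin a) (fromWitness a→r)))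

-- Walks along a matching

module Walks {n : ℕ} (τ : Matching n) where

  step^ : ℕ → Fin n → Maybe (Fin n)
  step^ zero    a = just a
  step^ (suc m) a = lookup τ a >>= step^ m

  -- A record, so that m, a and b can be inferred from a walk.
  record Walk (m : ℕ) (a b : Fin n) : Set where
    constructor walk
    field arrives : step^ m a ≡ just b

  []ʷ : ∀ {a} → Walk 0 a a
  []ʷ = walk refl

  Walk0⇒≡ : ∀ {a b} → Walk 0 a b → a ≡ b
  Walk0⇒≡ (walk p) = just-injective p

  _∷ʷ_ : ∀ {m a b c} → Edge τ a b → Walk m b c → Walk (suc m) a c
  _∷ʷ_ {m} e (walk w) = walk (trans (cong (_>>= step^ m) e) w)

  unconsʷ : ∀ {m a c} → Walk (suc m) a c → ∃ λ b → Edge τ a b × Walk m b c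
  unconsʷ {a = a} (walk w) with lookup τ a
  ... | just b = b , refl , walk w

  edge⇒walk : ∀ {a b} → Edge τ a b → Walk 1 a b
  edge⇒walk e = e ∷ʷ []ʷ

  walk⇒edge : ∀ {a b} → Walk 1 a b → Edge τ a b
  walk⇒edge w with unconsʷ w
  ... | _ , e , w₀ rewrite Walk0⇒≡ w₀ = e

  _++ʷ_ : ∀ {i j a b c} → Walk i a b → Walk j b c → Walk (i + j) a c
  _++ʷ_ {zero}  v w rewrite Walk0⇒≡ v = w
  _++ʷ_ {suc i} v w with unconsʷ v
  ... | _ , e , v′ = e ∷ʷ (v′ ++ʷ w)

  splitAtʷ : ∀ i {j a c} → Walk (i + j) a c → ∃ λ b → Walk i a b × Walk j b c
  splitAtʷ zero    w = _ , []ʷ , w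
  splitAtʷ (suc i) w with unconsʷ w
  ... | _ , e , w′ with splitAtʷ i w′
  ... | b , u , v = b , e ∷ʷ u , v

  Walk-functional : ∀ {m a b b′} → Walk m a b → Walk m a b′ → b ≡ b′
  Walk-functional (walk v) (walk w) = just-injective (trans (sym v) w)

  Edge-functional : ∀ {a b b′} → Edge τ a b → Edge τ a b′ → b ≡ b′
  Edge-functional e e′ = just-injective (trans (sym e) e′)

  unsnocʷ : ∀ m {a c} → Walk (suc m) a c → ∃ λ b → Walk m a b × Edge τ b c
  unsnocʷ m {a} {c} w with splitAtʷ m {1} (subst (λ k → Walk k a c) (ℕ.+-comm 1 m) w)
  ... | b , u , v = b , u , walk⇒edge v

  _∷ʳʷ_ : ∀ {m a b c} → Walk m a b → Edge τ b c → Walk (suc m) a c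
  _∷ʳʷ_ {m} {a} {c = c} w e = subst (λ k → Walk k a c) (ℕ.+-comm m 1) (w ++ʷ edge⇒walk e)

  prefixʷ : ∀ {m a c} i → i ℕ.≤ m → Walk m a c → ∃ λ y → Walk i a y × Walk (m ∸ i) y c
  prefixʷ {m} {a} {c} i i≤m w = splitAtʷ i (subst (λ k → Walk k a c) (sym (ℕ.m+[n∸m]≡n i≤m)) w)

  walk-repeats : ∀ {m a c} → n ℕ.≤ m → Walk m a c →
                 ∃ λ i → ∃ λ j → ∃ λ y → i ℕ.< j × j ℕ.≤ m ×
                 Walk i a y × Walk j a y × Walk (m ∸ i) y c × Walk (m ∸ j) y c
  walk-repeats n≤m w
    with Fin.pigeonhole (ℕ.s≤s n≤m) (λ k → proj₁ (prefixʷ (toℕ k) (Fin.toℕ≤pred[n] k) w))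
  ... | i , j , i<j , same-vertex
    with prefixʷ (toℕ i) (Fin.toℕ≤pred[n] i) w | prefixʷ (toℕ j) (Fin.toℕ≤pred[n] j) w
  ... | _ , uᵢ , vᵢ | y , uⱼ , vⱼ rewrite same-vertex =
    toℕ i , toℕ j , y , i<j , Fin.toℕ≤pred[n] j , uᵢ , uⱼ , vᵢ , vⱼ

  shorten : ∀ {m a c} → Walk m a c → ∃ λ m′ → m′ ℕ.< n × Walk m′ a c
  shorten {m} = go (suc m) ℕ.≤-refl
    where
    go : ∀ fuel {m a c} → m ℕ.< fuel → Walk m a c → ∃ λ m′ → m′ ℕ.< n × Walk m′ a c
    go (suc fuel) {m} m<fuel w with m ℕ.<? n
    ... | yes m<n = m , m<n , w
    ... | no  m≮n with walk-repeats (ℕ.≮⇒≥ m≮n) w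
    ... | i , j , _ , i<j , j≤m , uᵢ , _ , _ , vⱼ = go fuel shorter (uᵢ ++ʷ vⱼ)
      where
      shorter : i + (m ∸ j) ℕ.< fuel
      shorter = ℕ.<-≤-trans (subst (i + (m ∸ j) ℕ.<_) (ℕ.m+[n∸m]≡n j≤m) (ℕ.+-monoˡ-< (m ∸ j) i<j))
                            (ℕ.<⇒≤pred m<fuel)

  Reach : Fin n → Fin n → Set
  Reach a c = ∃ λ m → Walk m a c

  reach? : ∀ a c → Dec (Reach a c)
  reach? a c with Fin.any? (λ (k : Fin n) → walk? (toℕ k))
    where walk? : ∀ m → Dec (Walk m a c)
          walk? m with ≡-dec Fin._≟_ (step^ m a) (just c)
          ... | yes p = yes (walk p)
          ... | no ¬p = no λ w → ¬p (Walk.arrives w)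
  ... | yes (k , w) = yes (toℕ k , w)
  ... | no ¬w = no λ (m , w) → let (m′ , m′<n , w′) = shorten w in
    ¬w (Fin.fromℕ< m′<n , subst (λ k → Walk k a c) (sym (Fin.toℕ-fromℕ< m′<n)) w′)

  InI? : ∀ x → Dec (InI τ x)
  InI? x with lookup τ x
  ... | just b  = yes (b , refl)
  ... | nothing = no λ ()

  InJ? : ∀ x → Dec (InJ τ x)
  InJ? x = Fin.any? (λ c → ≡-dec Fin._≟_ (lookup τ c) (just x))

  Connected : Fin n → Fin n → Set
  Connected a c = Reach a c ⊎ Reach c a

  connected? : ∀ a c → Dec (Connected a c)
  connected? a c with reach? a c | reach? c a
  ... | yes r | _     = yes (inj₁ r)
  ... | no ¬r | yes r = yes (inj₂ r)
  ... | no ¬r | no ¬s = no λ { (inj₁ r) → ¬r r ; (inj₂ s) → ¬s s }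

  connected-refl : ∀ {a} → Connected a a
  connected-refl = inj₁ (0 , []ʷ)

  connected-sym : ∀ {a c} → Connected a c → Connected c a
  connected-sym (inj₁ r) = inj₂ r
  connected-sym (inj₂ r) = inj₁ r

  edge⇒connected : ∀ {a b} → Edge τ a b → Connected a b
  edge⇒connected e = inj₁ (1 , edge⇒walk e)

  revisit⇒InI : ∀ {p q y e} → Walk p y e → Walk q y e → p ℕ.< q → InI τ e
  revisit⇒InI {p} {y = y} {e} v w p<q with ℕ.m≤n⇒∃[o]m+o≡n p<q
  ... | o , refl with splitAtʷ p {suc o} (subst (λ k → Walk k y e) (sym (ℕ.+-suc p o)) w)
  ... | _ , u , w′ rewrite Walk-functional u v with unconsʷ w′
  ... | b , e→b , _ = b , e→b

  ¬InI⇒reached-from-¬InJ : ∀ e → ¬ InI τ e → ∃ λ d → ∃ λ s → Walk d s e × ¬ InJ τ s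
  ¬InI⇒reached-from-¬InJ e e∉I with back n
    where
    back : ∀ m → (∃ λ x → Walk m x e) ⊎ (∃ λ d → ∃ λ s → Walk d s e × ¬ InJ τ s)
    back zero = inj₁ (e , []ʷ)
    back (suc m) with back m
    ... | inj₂ found = inj₂ found
    ... | inj₁ (x , w) with InJ? x
    ...   | yes (c , c→x) = inj₁ (c , c→x ∷ʷ w)
    ...   | no  x∉J       = inj₂ (m , x , w , x∉J)
  ... | inj₂ found = found
  ... | inj₁ (_ , w) with walk-repeats ℕ.≤-refl w
  ... | _ , _ , _ , i<j , j≤n , _ , _ , vᵢ , vⱼ =
    ⊥-elim (e∉I (revisit⇒InI vⱼ vᵢ (ℕ.∸-monoʳ-< i<j j≤n)))

-- Clusters of an injective matching

EdgeInjective : ∀ {n} → Matching n → Set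
EdgeInjective {n} τ = ∀ a a′ b → Edge τ a b → Edge τ a′ b → a ≡ a′

module Clusters {n : ℕ} (τ : Matching n) (τ-injective : EdgeInjective τ) where

  open Walks τ public

  Walk-cancel : ∀ {m a a′ c} → Walk m a c → Walk m a′ c → a ≡ a′
  Walk-cancel {zero}  v w = trans (Walk0⇒≡ v) (sym (Walk0⇒≡ w))
  Walk-cancel {suc m} v w with unsnocʷ m v | unsnocʷ m w
  ... | _ , v′ , e | _ , w′ , e′ rewrite τ-injective _ _ _ e e′ = Walk-cancel v′ w′

  revisit⇒InJ : ∀ {i j s y} → Walk i s y → Walk j s y → i ℕ.< j → InJ τ s
  revisit⇒InJ {i} {s = s} {y} v w i<j with ℕ.m≤n⇒∃[o]m+o≡n i<j
  ... | o , refl with splitAtʷ (suc o) {i} (subst (λ k → Walk k s y) (cong suc (ℕ.+-comm i o)) w)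
  ... | _ , u , w′ rewrite Walk-cancel w′ v with unsnocʷ o u
  ... | b , _ , b→s = b , b→s

  ¬InJ⇒reaches-¬InI : ∀ s → ¬ InJ τ s → ∃ λ d → ∃ λ e → Walk d s e × ¬ InI τ e
  ¬InJ⇒reaches-¬InI s s∉J with forth n
    where
    forth : ∀ m → (∃ λ x → Walk m s x) ⊎ (∃ λ d → ∃ λ e → Walk d s e × ¬ InI τ e)
    forth zero = inj₁ (s , []ʷ)
    forth (suc m) with forth m
    ... | inj₂ found = inj₂ found
    ... | inj₁ (x , w) with InI? x
    ...   | yes (c , x→c) = inj₁ (c , w ∷ʳʷ x→c)
    ...   | no  x∉I       = inj₂ (m , x , w , x∉I)
  ... | inj₂ found = found
  ... | inj₁ (_ , w) with walk-repeats ℕ.≤-refl w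
  ... | _ , _ , _ , i<j , _ , uᵢ , uⱼ , _ = ⊥-elim (s∉J (revisit⇒InJ uᵢ uⱼ i<j))

  -- Two walks into one vertex, or out of one vertex, are nested: τ is injective and deterministic.
  walks-join⇒connected : ∀ {p q a a′ x} → Walk p a x → Walk q a′ x → Connected a a′
  walks-join⇒connected {p} {q} {a} {a′} {x} v w with ℕ.≤-total p q
  ... | inj₁ p≤q with ℕ.m≤n⇒∃[o]m+o≡n p≤q
  ...   | o , refl with splitAtʷ o {p} (subst (λ k → Walk k a′ x) (ℕ.+-comm p o) w)
  ...     | _ , u , w′ rewrite Walk-cancel w′ v = inj₂ (o , u)
  walks-join⇒connected {p} {q} {a} {a′} {x} v w | inj₂ q≤p with ℕ.m≤n⇒∃[o]m+o≡n q≤p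
  ...   | o , refl with splitAtʷ o {q} (subst (λ k → Walk k a x) (ℕ.+-comm q o) v)
  ...     | _ , u , v′ rewrite Walk-cancel v′ w = inj₁ (o , u)

  walks-fork⇒connected : ∀ {p q x a a′} → Walk p x a → Walk q x a′ → Connected a a′
  walks-fork⇒connected {p} {q} {x} {a} {a′} v w with ℕ.≤-total p q
  ... | inj₁ p≤q with ℕ.m≤n⇒∃[o]m+o≡n p≤q
  ...   | o , refl with splitAtʷ p {o} w
  ...     | _ , u , w′ rewrite Walk-functional u v = inj₁ (o , w′)
  walks-fork⇒connected {p} {q} {x} {a} {a′} v w | inj₂ q≤p with ℕ.m≤n⇒∃[o]m+o≡n q≤p
  ...   | o , refl with splitAtʷ q {o} v
  ...     | _ , u , v′ rewrite Walk-functional u w = inj₂ (o , v′)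

  connected-trans : ∀ {a x c} → Connected a x → Connected x c → Connected a c
  connected-trans (inj₁ (p , v)) (inj₁ (q , w)) = inj₁ (p + q , v ++ʷ w)
  connected-trans (inj₁ (_ , v)) (inj₂ (_ , w)) = walks-join⇒connected v w
  connected-trans (inj₂ (_ , v)) (inj₁ (_ , w)) = walks-fork⇒connected v w
  connected-trans (inj₂ (p , v)) (inj₂ (q , w)) = inj₂ (q + p , w ++ʷ v)

  ¬InJ-connected⇒≡ : ∀ {s s′} → ¬ InJ τ s → ¬ InJ τ s′ → Connected s s′ → s ≡ s′
  ¬InJ-connected⇒≡ _   _    (inj₁ (zero , w))  = Walk0⇒≡ w
  ¬InJ-connected⇒≡ _   s′∉J (inj₁ (suc m , w)) = let (b , _ , b→s′) = unsnocʷ m w in ⊥-elim (s′∉J (b , b→s′))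
  ¬InJ-connected⇒≡ _   _    (inj₂ (zero , w))  = sym (Walk0⇒≡ w)
  ¬InJ-connected⇒≡ s∉J _    (inj₂ (suc m , w)) = let (b , _ , b→s) = unsnocʷ m w in ⊥-elim (s∉J (b , b→s))

  Adj-sym : ∀ {e e′} → Adj τ e e′ → Adj τ e′ e
  Adj-sym (a→b , a′→b′ , inj₁ b≡a′) = a′→b′ , a→b , inj₂ b≡a′
  Adj-sym (a→b , a′→b′ , inj₂ b′≡a) = a′→b′ , a→b , inj₁ b′≡a

  Adj⇒Connected : ∀ {e e′} → Adj τ e e′ → Connected (proj₁ e) (proj₁ e′)
  Adj⇒Connected (a→b , _    , inj₁ refl) = edge⇒connected a→b
  Adj⇒Connected (_   , a′→a , inj₂ refl) = connected-sym (edge⇒connected a′→a)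

  SameCluster⇒Connected : ∀ {e e′} → SameCluster τ e e′ → Connected (proj₁ e) (proj₁ e′)
  SameCluster⇒Connected ε          = connected-refl
  SameCluster⇒Connected (adj ◅ sc) = connected-trans (Adj⇒Connected adj) (SameCluster⇒Connected sc)

  walk-into-I : ∀ {m c a b} → Walk m c a → Edge τ a b → InI τ c
  walk-into-I {zero}  w a→b rewrite Walk0⇒≡ w = _ , a→b
  walk-into-I {suc m} w _   = let (d , c→d , _) = unconsʷ w in d , c→d

  walk⇒SameCluster : ∀ m {a b a′ b′} → Edge τ a b → Walk m a a′ → Edge τ a′ b′ →
                     SameCluster τ (a , b) (a′ , b′)
  walk⇒SameCluster zero    a→b w a′→b′ rewrite Walk0⇒≡ w | Edge-functional a→b a′→b′ = ε
  walk⇒SameCluster (suc m) a→b w a′→b′ with unconsʷ w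
  ... | c , a→c , w′ rewrite Edge-functional a→b a→c =
    (a→c , c→d , inj₁ refl) ◅ walk⇒SameCluster m c→d w′ a′→b′
    where c→d = proj₂ (walk-into-I w′ a′→b′)

  Connected⇒SameCluster : ∀ {a b a′ b′} → Edge τ a b → Edge τ a′ b′ → Connected a a′ →
                          SameCluster τ (a , b) (a′ , b′)
  Connected⇒SameCluster a→b a′→b′ (inj₁ (m , w)) = walk⇒SameCluster m a→b w a′→b′
  Connected⇒SameCluster a→b a′→b′ (inj₂ (m , w)) =
    Star.reverse Adj-sym (walk⇒SameCluster m a′→b′ w a→b)

  module _ {σ : Matching n} (σ-edge⇒connected : ∀ {a b} → Edge σ a b → Connected a b) where

    σ-walk⇒connected : ∀ m {a c} → Walks.Walk σ m a c → Connected a c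
    σ-walk⇒connected zero    w = subst (Connected _) (Walks.Walk0⇒≡ σ w) connected-refl
    σ-walk⇒connected (suc m) w =
      let (_ , a→b , w′) = Walks.unconsʷ σ w in
      connected-trans (σ-edge⇒connected a→b) (σ-walk⇒connected m w′)

    σ-connected⇒connected : ∀ {a c} → Walks.Connected σ a c → Connected a c
    σ-connected⇒connected (inj₁ (m , w)) = σ-walk⇒connected m w
    σ-connected⇒connected (inj₂ (m , w)) = connected-sym (σ-walk⇒connected m w)

-- Reorienting open clusters

IsEndpoint : ∀ {n} → Matching n → Fin n → Set
IsEndpoint σ x = (InI σ x ⊎ InJ σ x) × (¬ InI σ x ⊎ ¬ InJ σ x)

module Reorientation {n : ℕ} (τ : Matching n) (τ-injective : EdgeInjective τ) where

  open Clusters τ τ-injective public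

  IsSource : Fin n → Set
  IsSource r = InI τ r × ¬ InJ τ r

  isSource? : ∀ r → Dec (T (inI τ r) × ¬ T (inJ τ r))
  isSource? r = T? (inI τ r) ×-dec ¬? (T? (inJ τ r))

  T⇔IsSource : ∀ {r} → (T (inI τ r) × ¬ T (inJ τ r)) ⇔ IsSource r
  T⇔IsSource {r} = mk⇔ (Product.map (to (T-inI τ r)) (_∘ from (T-inJ τ r)))
                       (Product.map (from (T-inI τ r)) (_∘ to (T-inJ τ r)))

  sources : List (Fin n)
  sources = filter isSource? (allFin n)

  #sources : ℕ
  #sources = length sources

  source : Fin #sources → Fin n
  source = List.lookup sources

  source-isSource : ∀ i → IsSource (source i)
  source-isSource i = to T⇔IsSource (proj₂ (∈-filter⁻ isSource? {xs = allFin n} (∈-lookup i)))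

  isSource⇒source : ∀ {r} → IsSource r → ∃ λ i → source i ≡ r
  isSource⇒source {r} s = Any.index r∈ , sym (lookup-index r∈)
    where r∈ = ∈-filter⁺ isSource? (∈-allFin r) (from T⇔IsSource s)

  source-injective : ∀ {i j} → source i ≡ source j → i ≡ j
  source-injective = Unique-lookup-injective (Unique.filter⁺ _ (Unique.allFin⁺ n)) _ _

  #sources≡p : ∀ k → size τ ≡ k → #sources ≡ p k τ
  #sources≡p k refl = sym (begin
    size τ ∸ cardIJ τ                ≡⟨ cong (_∸ cardIJ τ) (count-split (inI τ) (inJ τ) (allFin n)) ⟩
    cardIJ τ + #sources ∸ cardIJ τ   ≡⟨ ℕ.m+n∸m≡n (cardIJ τ) #sources ⟩
    #sources                         ∎)
    where open ≡-Reasoning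

  endpoint⇒source : ∀ {x} → IsEndpoint τ x → ∃ λ i → Connected (source i) x
  endpoint⇒source (inj₁ x∈I , inj₁ x∉I) = ⊥-elim (x∉I x∈I)
  endpoint⇒source (inj₂ x∈J , inj₂ x∉J) = ⊥-elim (x∉J x∈J)
  endpoint⇒source (inj₁ x∈I , inj₂ x∉J) with isSource⇒source (x∈I , x∉J)
  ... | i , refl = i , connected-refl
  endpoint⇒source {x} (inj₂ x∈J , inj₁ x∉I) with ¬InI⇒reached-from-¬InJ x x∉I
  ... | zero , s , w , s∉J rewrite Walk0⇒≡ w = ⊥-elim (s∉J x∈J)
  ... | suc d , s , w , s∉J with unconsʷ w
  ...   | b , s→b , _ with isSource⇒source ((b , s→b) , s∉J)
  ...     | i , refl = i , inj₁ (suc d , w)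

  Orientation : Set
  Orientation = Vec Bool #sources

  record Reversed (u : Orientation) (c : Fin n) : Set where
    constructor reversed
    field
      index    : Fin #sources
      chosen   : lookup u index ≡ true
      connects : Connected (source index) c

  reversed? : ∀ u c → Dec (Reversed u c)
  reversed? u c with Fin.any? (λ i → (lookup u i Bool.≟ true) ×-dec connected? (source i) c)
  ... | yes (i , b , sc) = yes (reversed i b sc)
  ... | no ¬r = no λ (reversed i b sc) → ¬r (i , b , sc)

  Reversed-resp : ∀ {u c c′} → Connected c c′ → Reversed u c → Reversed u c′
  Reversed-resp c~c′ (reversed i b s~c) = reversed i b (connected-trans s~c c~c′)

  Reversed-succ : ∀ {u a b} → Edge τ a b → Reversed u a → Reversed u b
  Reversed-succ = Reversed-resp ∘ edge⇒connected

  Reversed-pred : ∀ {u a b} → Edge τ a b → Reversed u b → Reversed u a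
  Reversed-pred = Reversed-resp ∘ connected-sym ∘ edge⇒connected

  preimage : Fin n → Maybe (Fin n)
  preimage x with InJ? x
  ... | yes (c , _) = just c
  ... | no _        = nothing

  reorient : Orientation → Matching n
  reorient u = tabulate λ x → if does (reversed? u x) then preimage x else lookup τ x

  module _ {u : Orientation} where

    lookup-reorient : ∀ x → lookup (reorient u) x ≡
                            (if does (reversed? u x) then preimage x else lookup τ x)
    lookup-reorient = lookup∘tabulate _

    reorient-edge⁻ : ∀ {a b} → Edge (reorient u) a b →
                     (Edge τ a b × ¬ Reversed u a) ⊎ (Edge τ b a × Reversed u b)
    reorient-edge⁻ {a} e rewrite lookup-reorient a with reversed? u a
    ... | no ¬r = inj₁ (e , ¬r)
    ... | yes r with InJ? a
    ...   | yes (c , c→a) with refl ← e = inj₂ (c→a , Reversed-pred c→a r)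

    reorient-keeps : ∀ {a b} → Edge τ a b → ¬ Reversed u a → Edge (reorient u) a b
    reorient-keeps {a} a→b ¬r rewrite lookup-reorient a with reversed? u a
    ... | no _  = a→b
    ... | yes r = ⊥-elim (¬r r)

    reorient-reverses : ∀ {a b} → Edge τ a b → Reversed u a → Edge (reorient u) b a
    reorient-reverses {a} {b} a→b r rewrite lookup-reorient b with reversed? u b
    ... | no ¬r = ⊥-elim (¬r (Reversed-succ a→b r))
    ... | yes _ with InJ? b
    ...   | yes (c , c→b) = cong just (τ-injective _ _ _ c→b a→b)
    ...   | no b∉J        = ⊥-elim (b∉J (a , a→b))

    reorient-edgeInjective : EdgeInjective (reorient u)
    reorient-edgeInjective a a′ b e e′ with reorient-edge⁻ e | reorient-edge⁻ e′
    ... | inj₁ (a→b , _)  | inj₁ (a′→b , _)  = τ-injective a a′ b a→b a′→b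
    ... | inj₂ (b→a , _)  | inj₂ (b→a′ , _)  = Edge-functional b→a b→a′
    ... | inj₁ (a→b , ¬r) | inj₂ (_ , r)     = ⊥-elim (¬r (Reversed-pred a→b r))
    ... | inj₂ (_ , r)    | inj₁ (a′→b , ¬r) = ⊥-elim (¬r (Reversed-pred a′→b r))

    private module ᵘ = Clusters (reorient u) reorient-edgeInjective

    reorient-edge⇒connected : ∀ {a b} → Edge (reorient u) a b → Connected a b
    reorient-edge⇒connected e with reorient-edge⁻ e
    ... | inj₁ (a→b , _) = edge⇒connected a→b
    ... | inj₂ (b→a , _) = connected-sym (edge⇒connected b→a)

    edge⇒reorient-connected : ∀ {a b} → Edge τ a b → ᵘ.Connected a b
    edge⇒reorient-connected {a} a→b with reversed? u a
    ... | no ¬r = ᵘ.edge⇒connected (reorient-keeps a→b ¬r)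
    ... | yes r = ᵘ.connected-sym (ᵘ.edge⇒connected (reorient-reverses a→b r))

    reorient-SameCluster⇒Connected : ∀ {a b a′ b′} → SameCluster (reorient u) (a , b) (a′ , b′) →
                                     Connected a a′
    reorient-SameCluster⇒Connected sc =
      σ-connected⇒connected reorient-edge⇒connected (ᵘ.SameCluster⇒Connected sc)

    Connected⇒reorient-SameCluster : ∀ {a b a′ b′} → Edge (reorient u) a b → Edge (reorient u) a′ b′ →
                                     Connected a a′ → SameCluster (reorient u) (a , b) (a′ , b′)
    Connected⇒reorient-SameCluster e e′ a~a′ =
      ᵘ.Connected⇒SameCluster e e′ (ᵘ.σ-connected⇒connected edge⇒reorient-connected a~a′)

    kept-InI : ∀ {x} → ¬ Reversed u x → InI (reorient u) x ⇔ InI τ x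
    kept-InI ¬r = mk⇔
      (λ (b , e) → case reorient-edge⁻ e of λ where
        (inj₁ (x→b , _)) → b , x→b
        (inj₂ (b→x , r)) → ⊥-elim (¬r (Reversed-succ b→x r)))
      (λ (b , x→b) → b , reorient-keeps x→b ¬r)

    kept-InJ : ∀ {x} → ¬ Reversed u x → InJ (reorient u) x ⇔ InJ τ x
    kept-InJ ¬r = mk⇔
      (λ (c , e) → case reorient-edge⁻ e of λ where
        (inj₁ (c→x , _)) → c , c→x
        (inj₂ (_ , r))   → ⊥-elim (¬r r))
      (λ (c , c→x) → c , reorient-keeps c→x (λ r → ¬r (Reversed-succ c→x r)))

    reversed-InI : ∀ {x} → Reversed u x → InI (reorient u) x ⇔ InJ τ x
    reversed-InI r = mk⇔
      (λ (b , e) → case reorient-edge⁻ e of λ where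
        (inj₁ (_ , ¬r))  → ⊥-elim (¬r r)
        (inj₂ (b→x , _)) → b , b→x)
      (λ (b , b→x) → b , reorient-reverses b→x (Reversed-pred b→x r))

    reversed-InJ : ∀ {x} → Reversed u x → InJ (reorient u) x ⇔ InI τ x
    reversed-InJ r = mk⇔
      (λ (c , e) → case reorient-edge⁻ e of λ where
        (inj₁ (c→x , ¬r)) → ⊥-elim (¬r (Reversed-pred c→x r))
        (inj₂ (x→c , _))  → c , x→c)
      (λ (c , x→c) → c , reorient-reverses x→c r)

    reorient-endpoint : ∀ {x} → IsEndpoint (reorient u) x → IsEndpoint τ x
    reorient-endpoint {x} (incident , missing) = by-cases (reversed? u x)
      where
      by-cases : Dec (Reversed u x) → IsEndpoint τ x
      by-cases (no ¬r) = Sum.map (to (kept-InI ¬r)) (to (kept-InJ ¬r)) incident ,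
                         Sum.map (_∘ from (kept-InI ¬r)) (_∘ from (kept-InJ ¬r)) missing
      by-cases (yes r) = Sum.swap (Sum.map (to (reversed-InI r)) (to (reversed-InJ r)) incident) ,
                         Sum.swap (Sum.map (_∘ from (reversed-InI r)) (_∘ from (reversed-InJ r)) missing)

    reorient-open⇒source : ∀ {a b} → OpenAt (reorient u) (a , b) → ∃ λ i → Connected (source i) a
    reorient-open⇒source (_ , a′ , b′ , sc , a′→b′ , inj₁ a′∉J)
      with endpoint⇒source (reorient-endpoint (inj₁ (b′ , a′→b′) , inj₂ a′∉J))
    ... | i , s~a′ = i , connected-trans s~a′ (connected-sym (reorient-SameCluster⇒Connected sc))
    reorient-open⇒source (_ , a′ , b′ , sc , a′→b′ , inj₂ b′∉I)
      with endpoint⇒source (reorient-endpoint (inj₂ (a′ , a′→b′) , inj₁ b′∉I))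
    ... | i , s~b′ = i , connected-trans s~b′ (connected-sym a~b′)
      where a~b′ = connected-trans (reorient-SameCluster⇒Connected sc) (reorient-edge⇒connected a′→b′)

    source⇒reorient-open : ∀ {a b i} → Edge (reorient u) a b → Connected (source i) a →
                           OpenAt (reorient u) (a , b)
    source⇒reorient-open {a} {b} {i} a→b s~a =
      let ((w , s→w) , s∉J) = source-isSource i in by-cases s→w s∉J (reversed? u (source i))
      where
      by-cases : ∀ {w} → Edge τ (source i) w → ¬ InJ τ (source i) → Dec (Reversed u (source i)) →
                 OpenAt (reorient u) (a , b)
      by-cases {w} s→w s∉J (no ¬r) =
        a→b , source i , w , Connected⇒reorient-SameCluster a→b s→ʷw (connected-sym s~a) , s→ʷw ,
        inj₁ (s∉J ∘ to (kept-InJ ¬r))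
        where s→ʷw = reorient-keeps s→w ¬r
      by-cases {w} s→w s∉J (yes r) =
        a→b , w , source i ,
        Connected⇒reorient-SameCluster a→b w→ʷs (connected-trans (connected-sym s~a) (edge⇒connected s→w)) ,
        w→ʷs , inj₂ (s∉J ∘ to (reversed-InI r))
        where w→ʷs = reorient-reverses s→w r

  module Toggle (u : Orientation) (i : Fin #sources) where

    u′ : Orientation
    u′ = u [ i ]%= not

    InCluster : Fin n → Set
    InCluster = Connected (source i)

    private
      index-unique : ∀ {j x} → Connected (source j) x → InCluster x → j ≡ i
      index-unique sj~x si~x = source-injective (¬InJ-connected⇒≡ (proj₂ (source-isSource _))
        (proj₂ (source-isSource i)) (connected-trans sj~x (connected-sym si~x)))

    Reversed-inside : ∀ {x} → InCluster x → Reversed u′ x ⇔ (¬ Reversed u x)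
    Reversed-inside {x} x∈C = mk⇔
      (λ (reversed j b′ sj~x) (reversed k b sk~x) →
        case index-unique sj~x x∈C , index-unique sk~x x∈C of λ where
          (refl , refl) → not-true≢true (trans (sym (lookup∘updateAt i u)) b′) b)
      (λ ¬r → reversed i (trans (lookup∘updateAt i u) (cong not (¬≡true ¬r))) x∈C)
      where
      not-true≢true : not (lookup u i) ≡ true → lookup u i ≡ true → ⊥
      not-true≢true e b rewrite b = case e of λ ()
      ¬≡true : ¬ Reversed u x → lookup u i ≡ false
      ¬≡true ¬r with lookup u i in b
      ... | true  = ⊥-elim (¬r (reversed i b x∈C))
      ... | false = refl

    Reversed-outside : ∀ {x} → ¬ InCluster x → Reversed u′ x ⇔ Reversed u x
    Reversed-outside {x} x∉C = mk⇔
      (λ (reversed j b sj~x) → reversed j (trans (sym (lookup∘updateAt′ j i (j≢i sj~x) u)) b) sj~x)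
      (λ (reversed j b sj~x) → reversed j (trans (lookup∘updateAt′ j i (j≢i sj~x) u) b) sj~x)
      where j≢i : ∀ {j} → Connected (source j) x → j ≢ i
            j≢i sj~x refl = x∉C sj~x

    toggled-edge⁻ : ∀ {a b} → Edge (reorient u′) a b →
                    (Edge (reorient u) a b × ¬ InCluster a) ⊎ (Edge (reorient u) b a × InCluster b)
    toggled-edge⁻ {a} {b} e = by-cases (reorient-edge⁻ e) (connected? (source i) a) (connected? (source i) b)
      where
      by-cases : (Edge τ a b × ¬ Reversed u′ a) ⊎ (Edge τ b a × Reversed u′ b) →
                 Dec (InCluster a) → Dec (InCluster b) →
                 (Edge (reorient u) a b × ¬ InCluster a) ⊎ (Edge (reorient u) b a × InCluster b)
      by-cases (inj₁ (a→b , ¬r′)) (yes a∈C) _ =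
        let r = decidable-stable (reversed? u a) (¬r′ ∘ from (Reversed-inside a∈C)) in
        inj₂ (reorient-reverses a→b r , connected-trans a∈C (edge⇒connected a→b))
      by-cases (inj₁ (a→b , ¬r′)) (no a∉C) _ =
        inj₁ (reorient-keeps a→b (¬r′ ∘ from (Reversed-outside a∉C)) , a∉C)
      by-cases (inj₂ (b→a , r′)) _ (yes b∈C) =
        inj₂ (reorient-keeps b→a (to (Reversed-inside b∈C) r′) , b∈C)
      by-cases (inj₂ (b→a , r′)) _ (no b∉C) =
        inj₁ (reorient-reverses b→a (to (Reversed-outside b∉C) r′) ,
              b∉C ∘ λ a∈C → connected-trans a∈C (connected-sym (edge⇒connected b→a)))

    toggled-edge⁺ : ∀ {a b} →
                    (Edge (reorient u) a b × ¬ InCluster a) ⊎ (Edge (reorient u) b a × InCluster b) →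
                    Edge (reorient u′) a b
    toggled-edge⁺ (inj₁ (e , a∉C)) with reorient-edge⁻ e
    ... | inj₁ (a→b , ¬r) = reorient-keeps a→b (¬r ∘ to (Reversed-outside a∉C))
    ... | inj₂ (b→a , r)  = reorient-reverses b→a (from (Reversed-outside (a∉C ∘ λ b∈C →
                              connected-trans b∈C (edge⇒connected b→a))) r)
    toggled-edge⁺ (inj₂ (e , b∈C)) with reorient-edge⁻ e
    ... | inj₁ (b→a , ¬r) = reorient-reverses b→a (from (Reversed-inside b∈C) ¬r)
    ... | inj₂ (a→b , r)  = reorient-keeps a→b (λ r′ → to (Reversed-inside a∈C) r′ r)
      where a∈C = connected-trans b∈C (connected-sym (edge⇒connected a→b))

    SameCluster⇔InCluster : ∀ {a₀ b₀ a b} → Edge (reorient u) a₀ b₀ → InCluster a₀ → Edge (reorient u) a b →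
                            SameCluster (reorient u) (a₀ , b₀) (a , b) ⇔ InCluster a
    SameCluster⇔InCluster e₀ a₀∈C e = mk⇔
      (λ sc → connected-trans a₀∈C (reorient-SameCluster⇒Connected sc))
      (λ a∈C → Connected⇒reorient-SameCluster e₀ e (connected-trans (connected-sym a₀∈C) a∈C))

    flip-characterisation : ∀ {a₀ b₀} → Edge (reorient u) a₀ b₀ → InCluster a₀ → ∀ a b →
      Edge (reorient u′) a b ⇔
        ((Edge (reorient u) a b × ¬ SameCluster (reorient u) (a₀ , b₀) (a , b)) ⊎
         (Edge (reorient u) b a × SameCluster (reorient u) (a₀ , b₀) (b , a)))
    flip-characterisation e₀ a₀∈C a b = ⇔.trans (mk⇔ toggled-edge⁻ toggled-edge⁺) (mk⇔
      (Sum.map (λ (e , a∉C) → e , a∉C ∘ to (SameCluster⇔InCluster e₀ a₀∈C e))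
               (λ (e , b∈C) → e , from (SameCluster⇔InCluster e₀ a₀∈C e) b∈C))
      (Sum.map (λ (e , ¬sc) → e , ¬sc ∘ from (SameCluster⇔InCluster e₀ a₀∈C e))
               (λ (e , sc) → e , to (SameCluster⇔InCluster e₀ a₀∈C e) sc)))

    flip-at : ∀ {x y a₀ b₀} → x Fin.< y → ((a₀ , b₀) ≡ (x , y) ⊎ (a₀ , b₀) ≡ (y , x)) →
              Edge (reorient u) a₀ b₀ → InCluster a₀ → FlipStep (reorient u) (reorient u′)
    flip-at {x} {y} {a₀} {b₀} x<y e₀≡xy e₀ a₀∈C =
      x , y , x<y ,
      inj₁ ((a₀ , b₀) , (e₀≡xy , source⇒reorient-open e₀ a₀∈C) , flip-characterisation e₀ a₀∈C)

    toggle⇒FlipStep : FlipStep (reorient u) (reorient u′)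
    toggle⇒FlipStep =
      let ((w , s→w) , s∉J) = source-isSource i in
      flip-at-source s→w s∉J (reversed? u (source i)) (Fin.<-cmp (source i) w)
      where
      flip-at-source : ∀ {w} → Edge τ (source i) w → ¬ InJ τ (source i) → Dec (Reversed u (source i)) →
                       Tri (source i Fin.< w) (source i ≡ w) (w Fin.< source i) →
                       FlipStep (reorient u) (reorient u′)
      flip-at-source s→w s∉J _ (tri≈ _ refl _) = ⊥-elim (s∉J (_ , s→w))
      flip-at-source s→w _ (no ¬r) (tri< s<w _ _) = flip-at s<w (inj₁ refl) (reorient-keeps s→w ¬r) connected-refl
      flip-at-source s→w _ (no ¬r) (tri> _ _ w<s) = flip-at w<s (inj₂ refl) (reorient-keeps s→w ¬r) connected-refl
      flip-at-source s→w _ (yes r) (tri< s<w _ _) =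
        flip-at s<w (inj₂ refl) (reorient-reverses s→w r) (edge⇒connected s→w)
      flip-at-source s→w _ (yes r) (tri> _ _ w<s) =
        flip-at w<s (inj₁ refl) (reorient-reverses s→w r) (edge⇒connected s→w)

  FlipStep-closed : ∀ {u σ} → FlipStep (reorient u) σ → ∃ λ v → σ ≡ reorient v
  FlipStep-closed {u} (_ , _ , _ , inj₂ (_ , σ≡)) = u , σ≡
  FlipStep-closed {u} (_ , _ , _ , inj₁ ((a₀ , b₀) , (_ , open₀) , edges)) =
    let (i , s~a₀) = reorient-open⇒source open₀ in
    Toggle.u′ u i , Matching-ext λ a b →
      ⇔.trans (edges a b) (⇔.sym (Toggle.flip-characterisation u i (proj₁ open₀) s~a₀ a b))

  reorient-orbit-closed : ∀ u {σ} → InOrbit (reorient u) σ → ∃ λ v → σ ≡ reorient v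
  reorient-orbit-closed u ε = u , refl
  reorient-orbit-closed u (step ◅ steps) with FlipStep-closed step
  ... | v , refl = reorient-orbit-closed v steps

  reorient-unreversed : ∀ {u} → (∀ x → ¬ Reversed u x) → reorient u ≡ τ
  reorient-unreversed ¬r = Matching-ext λ a b → mk⇔
    (λ e → Sum.[ proj₁ , (λ (_ , r) → ⊥-elim (¬r b r)) ] (reorient-edge⁻ e))
    (λ a→b → reorient-keeps a→b (¬r a))

  reorient-allFalse : reorient (replicate #sources false) ≡ τ
  reorient-allFalse = reorient-unreversed λ x (reversed i b _) →
    case trans (sym (lookup-replicate i false)) b of λ ()

  reorientations⊆orbit : ∀ u → InOrbit τ (reorient u)
  reorientations⊆orbit u = subst (λ σ → InOrbit σ (reorient u)) reorient-allFalse
    (Star.gmap reorient (λ { (i , refl) → Toggle.toggle⇒FlipStep _ i }) (allFalse-BitFlips u))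

  orbit⊆reorientations : ∀ {σ} → InOrbit τ σ → ∃ λ v → σ ≡ reorient v
  orbit⊆reorientations {σ} orbit =
    reorient-orbit-closed (replicate #sources false) (subst (λ ρ → InOrbit ρ σ) (sym reorient-allFalse) orbit)

  chosen⇔¬InI : ∀ u i → lookup u i ≡ true ⇔ (¬ InI (reorient u) (source i))
  chosen⇔¬InI u i = mk⇔
    (λ b s∈Iᵘ → s∉J (to (reversed-InI (reversed i b connected-refl)) s∈Iᵘ))
    (λ s∉Iᵘ → case reversed? u (source i) of λ where
      (yes (reversed j b sj~s)) → subst (λ k → lookup u k ≡ true)
                                        (source-injective (¬InJ-connected⇒≡ (proj₂ (source-isSource j)) s∉J sj~s)) b
      (no ¬r) → ⊥-elim (s∉Iᵘ (from (kept-InI ¬r) (proj₁ (source-isSource i)))))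
    where s∉J = proj₂ (source-isSource i)

  reorient-injective : ∀ {u v} → reorient u ≡ reorient v → u ≡ v
  reorient-injective {u} {v} eq = Vec-ext λ i → reflects-≡ Bool.T-≡ Bool.T-≡ (same-choice i)
    where
    same-choice : ∀ i → lookup u i ≡ true ⇔ lookup v i ≡ true
    same-choice i = ⇔.trans (chosen⇔¬InI u i)
      (subst (λ σ → (¬ InI σ (source i)) ⇔ (lookup v i ≡ true)) (sym eq) (⇔.sym (chosen⇔¬InI v i)))

orbit-enumeration : ∀ {n} k (τ : Matching n) → IsMatching k τ →
  Σ (List (Matching n)) λ xs → Unique xs × (∀ σ → σ ∈ xs ⇔ InOrbit τ σ) × length xs ≡ 2 ^ p k τ
orbit-enumeration k τ (τ-injective , size≡k) =
  List.map reorient (allBitVecs #sources) ,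
  Unique.map⁺ reorient-injective (allBitVecs-unique #sources) ,
  (λ σ → mk⇔ listed⇒orbit orbit⇒listed) ,
  (begin
    length (List.map reorient (allBitVecs #sources)) ≡⟨ length-map reorient (allBitVecs #sources) ⟩
    length (allBitVecs #sources)                     ≡⟨ length-allBitVecs #sources ⟩
    2 ^ #sources                                     ≡⟨ cong (2 ^_) (#sources≡p k size≡k) ⟩
    2 ^ p k τ                                        ∎)
  where
  open Reorientation τ τ-injective
  open ≡-Reasoning

  listed⇒orbit : ∀ {σ} → σ ∈ List.map reorient (allBitVecs #sources) → InOrbit τ σ
  listed⇒orbit σ∈ with ∈-map⁻ reorient σ∈
  ... | u , _ , refl = reorientations⊆orbit u

  orbit⇒listed : ∀ {σ} → InOrbit τ σ → σ ∈ List.map reorient (allBitVecs #sources)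
  orbit⇒listed orbit with orbit⊆reorientations orbit
  ... | v , refl = ∈-map⁺ reorient (∈-allBitVecs v)

-- Interlaced lists

module _ {n : ℕ} where

  #below : Fin n → List (Fin n) → ℕ
  #below m xs = length (filter (Fin._<? m) xs)

  Interlaced : List (Fin n) → List (Fin n) → Set
  Interlaced xs ys = AllPairs Fin._<_ xs × AllPairs Fin._<_ ys × AllPairs Fin._≤_ (interleave {n} xs ys)

  private
    #below-none : ∀ {m} xs → All (λ z → ¬ z Fin.< m) xs → #below m xs ≡ 0
    #below-none {m} _ = cong length ∘ filter-none (Fin._<? m)

    #below-∷ : ∀ {m x} xs → x Fin.< m → #below m (x ∷ xs) ≡ suc (#below m xs)
    #below-∷ {m} xs x<m = cong length (filter-accept (Fin._<? m) x<m)

    filter-<-∷ : ∀ {m x : Fin n} {xs ys} → filter (Fin._<? m) xs ≡ filter (Fin._<? m) ys →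
                 filter (Fin._<? m) (x ∷ xs) ≡ filter (Fin._<? m) (x ∷ ys)
    filter-<-∷ {m} {x} eq with does (x Fin.<? m)
    ... | true  = cong (x ∷_) eq
    ... | false = eq

    ∈-interleaveˡ : ∀ {z : Fin n} xs ys → z ∈ xs → z ∈ interleave {n} xs ys
    ∈-interleaveˡ (x ∷ xs) []       z∈       = z∈
    ∈-interleaveˡ (x ∷ xs) (y ∷ ys) (here p) = here p
    ∈-interleaveˡ (x ∷ xs) (y ∷ ys) (there z∈) = there (there (∈-interleaveˡ xs ys z∈))

    ≥∧≢⇒≮ : ∀ {a m : Fin n} → m Fin.≤ a → a ≢ m → ¬ a Fin.< m
    ≥∧≢⇒≮ m≤a a≢m = Fin.<-asym (Fin.≤∧≢⇒< m≤a (a≢m ∘ sym))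

  -- In x₁ ≤ y₁ ≤ x₂ ≤ y₂ ≤ …, a point xᵣ that is not a y has r − 1 elements of each list below it
  -- (given that yᵣ exists), and a point yᵣ that is not an x has r xs and r − 1 ys below it.
  interlaced-#below-∈ˡ : ∀ {m y} xs ys → Interlaced xs ys → m ∈ xs → m ∉ ys → y ∈ ys → m Fin.< y →
                         #below m xs ≡ #below m ys
  interlaced-#below-∈ˡ [] _ _ () _ _ _
  interlaced-#below-∈ˡ (_ ∷ _) [] _ _ _ () _
  interlaced-#below-∈ˡ {m} (x ∷ xs) (y ∷ ys) (x< ∷ _ , y< ∷ _ , x≤ ∷ _) (here refl) m∉ _ _ =
    trans (#below-none (x ∷ xs) (Fin.<-irrefl refl ∷ All.map Fin.<-asym x<))
          (sym (#below-none (y ∷ ys) (y≮m ∷ All.map (λ y<z z<m → y≮m (Fin.<-trans y<z z<m)) y<)))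
    where y≮m = ≥∧≢⇒≮ (All.head x≤) (λ y≡m → m∉ (here (sym y≡m)))
  interlaced-#below-∈ˡ {m} (x ∷ xs) (y ∷ ys) (x< ∷ sx , y< ∷ sy , x≤ ∷ y≤ ∷ lp) (there m∈) m∉ y′∈ m<y′ =
    trans (#below-∷ xs x<m)
          (trans (cong suc (interlaced-#below-∈ˡ xs ys (sx , sy , lp) m∈ (m∉ ∘ there) (drop y′∈ m<y′) m<y′))
                 (sym (#below-∷ ys y<m)))
    where
    x<m = All.lookup x< m∈
    y<m = Fin.≤∧≢⇒< (All.lookup y≤ (∈-interleaveˡ xs ys m∈)) (λ y≡m → m∉ (here (sym y≡m)))
    drop : ∀ {z} → z ∈ y ∷ ys → m Fin.< z → z ∈ ys
    drop (here refl) m<y = ⊥-elim (Fin.<-asym y<m m<y)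
    drop (there z∈)  _   = z∈

  interlaced-#below-∈ʳ : ∀ {m x} xs ys → Interlaced xs ys → m ∈ ys → m ∉ xs → x ∈ xs → m Fin.< x →
                         #below m xs ≡ suc (#below m ys)
  interlaced-#below-∈ʳ [] _ _ _ _ () _
  interlaced-#below-∈ʳ (_ ∷ _) [] _ () _ _ _
  interlaced-#below-∈ʳ {m} (x ∷ xs) (y ∷ ys) (_ ∷ _ , y< ∷ _ , x≤ ∷ y≤ ∷ _) (here refl) m∉ _ _ =
    trans (#below-∷ xs x<m)
          (cong suc (trans (#below-none xs (All.tabulate λ z∈ → ≥∧≢⇒≮ (All.lookup y≤ (∈-interleaveˡ xs ys z∈))
                                                                   (λ z≡m → m∉ (there (subst (_∈ xs) z≡m z∈)))))
                           (sym (#below-none (y ∷ ys) (Fin.<-irrefl refl ∷ All.map Fin.<-asym y<)))))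
    where x<m = Fin.≤∧≢⇒< (All.head x≤) (λ x≡m → m∉ (here (sym x≡m)))
  interlaced-#below-∈ʳ {m} (x ∷ xs) (y ∷ ys) (_ ∷ sx , y< ∷ sy , x≤ ∷ _ ∷ lp) (there m∈) m∉ x′∈ m<x′ =
    trans (#below-∷ xs x<m)
          (cong suc (trans (interlaced-#below-∈ʳ xs ys (sx , sy , lp) m∈ (m∉ ∘ there) (drop x′∈ m<x′) m<x′)
                           (sym (#below-∷ ys y<m))))
    where
    y<m = All.lookup y< m∈
    x<m = ℕ.≤-<-trans (All.head x≤) y<m
    drop : ∀ {z} → z ∈ x ∷ xs → m Fin.< z → z ∈ xs
    drop (here refl) m<x = ⊥-elim (Fin.<-asym x<m m<x)
    drop (there z∈)  _   = z∈

  interlacing-mismatch : ∀ {m e} I₁ J₁ I₂ J₂ → Interlaced I₁ J₁ → Interlaced I₂ J₂ →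
    #below m I₁ ≡ #below m I₂ → #below m J₁ ≡ #below m J₂ →
    m ∈ I₁ → m ∉ J₁ → e ∈ J₁ → m ∈ J₂ → m ∉ I₂ → e ∈ I₂ → m Fin.< e → ⊥
  interlacing-mismatch {m} I₁ J₁ I₂ J₂ il₁ il₂ I≡ J≡ m∈I₁ m∉J₁ e∈J₁ m∈J₂ m∉I₂ e∈I₂ m<e =
    ℕ.1+n≢n (begin
      suc (#below m J₁) ≡⟨ cong suc J≡ ⟩
      suc (#below m J₂) ≡⟨ interlaced-#below-∈ʳ I₂ J₂ il₂ m∈J₂ m∉I₂ e∈I₂ m<e ⟨
      #below m I₂       ≡⟨ I≡ ⟨
      #below m I₁       ≡⟨ interlaced-#below-∈ˡ I₁ J₁ il₁ m∈I₁ m∉J₁ e∈J₁ m<e ⟩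
      #below m J₁       ∎)
    where open ≡-Reasoning

  filter-<-cong : ∀ {P Q : Fin n → Set} (P? : Decidable P) (Q? : Decidable Q) {m} →
                  (∀ {x} → x Fin.< m → P x ⇔ Q x) → ∀ L →
                  filter (Fin._<? m) (filter P? L) ≡ filter (Fin._<? m) (filter Q? L)
  filter-<-cong P? Q? P⇔Q [] = refl
  filter-<-cong P? Q? {m} P⇔Q (x ∷ L) with P? x | Q? x | x Fin.<? m
  ... | yes _ | yes _ | _       = filter-<-∷ {m} {x} (filter-<-cong P? Q? P⇔Q L)
  ... | no  _ | no  _ | _       = filter-<-cong P? Q? P⇔Q L
  ... | yes p | no ¬q | yes x<m = ⊥-elim (¬q (to (P⇔Q x<m) p))
  ... | no ¬p | yes q | yes x<m = ⊥-elim (¬p (from (P⇔Q x<m) q))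
  ... | yes _ | no  _ | no x≮m  = trans (filter-reject (Fin._<? m) x≮m) (filter-<-cong P? Q? P⇔Q L)
  ... | no  _ | yes _ | no x≮m  = trans (filter-<-cong P? Q? P⇔Q L) (sym (filter-reject (Fin._<? m) x≮m))

module _ {n : ℕ} (σ : Matching n) where

  ∈-Ilist : ∀ {x} → x ∈ Ilist σ ⇔ InI σ x
  ∈-Ilist {x} = mk⇔
    (λ x∈ → to (T-inI σ x) (proj₂ (∈-filter⁻ (λ r → T? (inI σ r)) {xs = allFin n} x∈)))
    (λ x∈I → ∈-filter⁺ (λ r → T? (inI σ r)) (∈-allFin x) (from (T-inI σ x) x∈I))

  ∈-Jlist : ∀ {x} → x ∈ Jlist σ ⇔ InJ σ x
  ∈-Jlist {x} = mk⇔
    (λ x∈ → to (T-inJ σ x) (proj₂ (∈-filter⁻ (λ r → T? (inJ σ r)) {xs = allFin n} x∈)))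
    (λ x∈J → ∈-filter⁺ (λ r → T? (inJ σ r)) (∈-allFin x) (from (T-inJ σ x) x∈J))

  Interlacing⇒Interlaced : Interlacing σ → Interlaced (Ilist σ) (Jlist σ)
  Interlacing⇒Interlaced il = sorted (inI σ) , sorted (inJ σ) , Linked⇒AllPairs Fin.≤-trans il
    where sorted : ∀ f → AllPairs Fin._<_ (filter (λ r → T? (f r)) (allFin n))
          sorted f = AllPairs.filter⁺ (λ r → T? (f r)) (AllPairs.tabulate⁺-< id)

module _ {n : ℕ} (σ σ′ : Matching n) {m : Fin n} where

  #below-Ilist-cong : (∀ {x} → x Fin.< m → InI σ x ⇔ InI σ′ x) → #below m (Ilist σ) ≡ #below m (Ilist σ′)
  #below-Ilist-cong same = cong length (filter-<-cong _ _
    (λ {x} x<m → ⇔.trans (T-inI σ x) (⇔.trans (same x<m) (⇔.sym (T-inI σ′ x)))) (allFin n))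

  #below-Jlist-cong : (∀ {x} → x Fin.< m → InJ σ x ⇔ InJ σ′ x) → #below m (Jlist σ) ≡ #below m (Jlist σ′)
  #below-Jlist-cong same = cong length (filter-<-cong _ _
    (λ {x} x<m → ⇔.trans (T-inJ σ x) (⇔.trans (same x<m) (⇔.sym (T-inJ σ′ x)))) (allFin n))

module _ {n : ℕ} (σ₁ σ₂ : Matching n) {m e : Fin n} where

  interlacing-side-swap : Interlacing σ₁ → Interlacing σ₂ →
    (∀ {x} → x Fin.< m → InI σ₁ x ⇔ InI σ₂ x) → (∀ {x} → x Fin.< m → InJ σ₁ x ⇔ InJ σ₂ x) →
    InI σ₁ m → ¬ InJ σ₁ m → InJ σ₁ e → InJ σ₂ m → ¬ InI σ₂ m → InI σ₂ e → m Fin.< e → ⊥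
  interlacing-side-swap il₁ il₂ I-below J-below m∈I₁ m∉J₁ e∈J₁ m∈J₂ m∉I₂ e∈I₂ m<e =
    interlacing-mismatch (Ilist σ₁) (Jlist σ₁) (Ilist σ₂) (Jlist σ₂)
      (Interlacing⇒Interlaced σ₁ il₁) (Interlacing⇒Interlaced σ₂ il₂)
      (#below-Ilist-cong σ₁ σ₂ I-below) (#below-Jlist-cong σ₁ σ₂ J-below)
      (from (∈-Ilist σ₁) m∈I₁) (m∉J₁ ∘ to (∈-Jlist σ₁)) (from (∈-Jlist σ₁) e∈J₁)
      (from (∈-Jlist σ₂) m∈J₂) (m∉I₂ ∘ to (∈-Ilist σ₂)) (from (∈-Ilist σ₂) e∈I₂) m<e

below-smallest : ∀ {n} {P : Fin n → Set} m → ((j : Fin.Fin′ m) → P (Fin.inject j)) → ∀ {x} → x Fin.< m → P x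
below-smallest {P = P} m below {x} x<m =
  subst P (Fin.toℕ-injective (trans (Fin.toℕ-inject (Fin.fromℕ< x<m)) (Fin.toℕ-fromℕ< x<m)))
          (below (Fin.fromℕ< x<m))

module InterlacedReorientation {n : ℕ} (τ : Matching n) (τ-injective : EdgeInjective τ)
                               (w : Reorientation.Orientation τ τ-injective) where

  open Reorientation τ τ-injective

  σ : Matching n
  σ = reorient w

  Agree : Fin n → Set
  Agree x = (inI σ x ≡ inI τ x) × (inJ σ x ≡ inJ τ x)

  agree? : ∀ x → Dec (Agree x)
  agree? x = (inI σ x Bool.≟ inI τ x) ×-dec (inJ σ x Bool.≟ inJ τ x)

  Agree⇒InI⇔ : ∀ {x} → Agree x → InI σ x ⇔ InI τ x
  Agree⇒InI⇔ {x} (eqI , _) = reflects-⇔ (T-inI σ x) (T-inI τ x) eqI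

  Agree⇒InJ⇔ : ∀ {x} → Agree x → InJ σ x ⇔ InJ τ x
  Agree⇒InJ⇔ {x} (_ , eqJ) = reflects-⇔ (T-inJ σ x) (T-inJ τ x) eqJ

  kept⇒agree : ∀ {x} → ¬ Reversed w x → Agree x
  kept⇒agree {x} ¬r =
    reflects-≡ (T-inI σ x) (T-inI τ x) (kept-InI ¬r) , reflects-≡ (T-inJ σ x) (T-inJ τ x) (kept-InJ ¬r)

  reversed∧agree⇒balanced : ∀ {x} → Reversed w x → Agree x → InI τ x ⇔ InJ τ x
  reversed∧agree⇒balanced r agree = ⇔.trans (⇔.sym (Agree⇒InI⇔ agree)) (reversed-InI r)

  reversed∧balanced⇒agree : ∀ {x} → Reversed w x → InI τ x ⇔ InJ τ x → Agree x
  reversed∧balanced⇒agree {x} r I⇔J =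
    reflects-≡ (T-inI σ x) (T-inI τ x) (⇔.trans (reversed-InI r) (⇔.sym I⇔J)) ,
    reflects-≡ (T-inJ σ x) (T-inJ τ x) (⇔.trans (reversed-InJ r) I⇔J)

  first-disagreement-after : ∀ {m e} → (∀ {x} → x Fin.< m → Agree x) → ¬ Agree e → e ≢ m → m Fin.< e
  first-disagreement-after {m} {e} agree-below ¬agree e≢m = by-cases (Fin.<-cmp e m)
    where
    by-cases : Tri (e Fin.< m) (e ≡ m) (m Fin.< e) → m Fin.< e
    by-cases (tri< e<m _ _) = ⊥-elim (¬agree (agree-below e<m))
    by-cases (tri≈ _ e≡m _) = ⊥-elim (e≢m e≡m)
    by-cases (tri> _ _ m<e) = m<e

  module _ (τ-interlacing : Interlacing τ) (σ-interlacing : Interlacing σ)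
           {m : Fin n} (agree-below : ∀ {x} → x Fin.< m → Agree x) (r : Reversed w m) where

    -- The far end e of the path of a reversed source m also changes side, and e > m: in τ the vertex m
    -- starts a pair xᵣ ≤ yᵣ of the interlacing, in σ it ends one, although both agree below m.
    reversed-source-impossible : InI τ m → ¬ InJ τ m → ⊥
    reversed-source-impossible m∈I m∉J with ¬InJ⇒reaches-¬InI m m∉J
    ... | zero  , e , path , e∉I = e∉I (subst (InI τ) (Walk0⇒≡ path) m∈I)
    ... | suc d , e , path , e∉I =
      interlacing-side-swap τ σ τ-interlacing σ-interlacing
        (λ x<m → ⇔.sym (Agree⇒InI⇔ (agree-below x<m))) (λ x<m → ⇔.sym (Agree⇒InJ⇔ (agree-below x<m)))
        m∈I m∉J e∈J (from (reversed-InJ r) m∈I) (m∉J ∘ to (reversed-InI r)) (from (reversed-InI re) e∈J)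
        (first-disagreement-after agree-below
          (λ agree → e∉I (from (reversed∧agree⇒balanced re agree) e∈J))
          (λ e≡m → e∉I (subst (InI τ) (sym e≡m) m∈I)))
      where
      e∈J : InJ τ e
      e∈J = let (b , _ , b→e) = unsnocʷ d path in b , b→e
      re : Reversed w e
      re = Reversed-resp (inj₁ (suc d , path)) r

    reversed-sink-impossible : ¬ InI τ m → InJ τ m → ⊥
    reversed-sink-impossible m∉I m∈J with ¬InI⇒reached-from-¬InJ m m∉I
    ... | zero  , s , path , s∉J = s∉J (subst (InJ τ) (sym (Walk0⇒≡ path)) m∈J)
    ... | suc d , s , path , s∉J =
      interlacing-side-swap σ τ σ-interlacing τ-interlacing
        (λ x<m → Agree⇒InI⇔ (agree-below x<m)) (λ x<m → Agree⇒InJ⇔ (agree-below x<m))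
        (from (reversed-InI r) m∈J) (m∉I ∘ to (reversed-InJ r)) (from (reversed-InJ rs) s∈I) m∈J m∉I s∈I
        (first-disagreement-after agree-below
          (λ agree → s∉J (to (reversed∧agree⇒balanced rs agree) s∈I))
          (λ s≡m → s∉J (subst (InJ τ) (sym s≡m) m∈J)))
      where
      s∈I : InI τ s
      s∈I = let (b , s→b , _) = unconsʷ path in b , s→b
      rs : Reversed w s
      rs = Reversed-resp (connected-sym (inj₁ (suc d , path))) r

  module _ (τ-interlacing : Interlacing τ) (σ-interlacing : Interlacing σ) where

    first-disagreement-impossible : ∀ m → ¬ Agree m → (∀ {x} → x Fin.< m → Agree x) → ⊥
    first-disagreement-impossible m ¬agree agree-below = by-cases (reversed? w m) (InI? m) (InJ? m)
      where
      by-cases : Dec (Reversed w m) → Dec (InI τ m) → Dec (InJ τ m) → ⊥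
      by-cases (no ¬r) _ _ = ¬agree (kept⇒agree ¬r)
      by-cases (yes r) (yes m∈I) (yes m∈J) = ¬agree (reversed∧balanced⇒agree r (mk⇔ (λ _ → m∈J) (λ _ → m∈I)))
      by-cases (yes r) (no  m∉I) (no  m∉J) = ¬agree (reversed∧balanced⇒agree r (mk⇔ (⊥-elim ∘ m∉I) (⊥-elim ∘ m∉J)))
      by-cases (yes r) (yes m∈I) (no  m∉J) =
        reversed-source-impossible τ-interlacing σ-interlacing agree-below r m∈I m∉J
      by-cases (yes r) (no  m∉I) (yes m∈J) =
        reversed-sink-impossible τ-interlacing σ-interlacing agree-below r m∉I m∈J

    interlacing⇒unreversed : ∀ x → ¬ Reversed w x
    interlacing⇒unreversed _ (reversed i chosen _) =
      let (m , ¬agree , agree-below) =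
            Fin.¬∀⟶∃¬-smallest n Agree agree? (λ all → source-disagrees (all (source i))) in
      first-disagreement-impossible m ¬agree (below-smallest m agree-below)
      where
      source-disagrees : ¬ Agree (source i)
      source-disagrees agree = let (s∈I , s∉J) = source-isSource i in
        s∉J (to (reversed∧agree⇒balanced (reversed i chosen connected-refl) agree) s∈I)

interlacing-orbit-unique : ∀ {n k} (τ σ : Matching n) → IsMatching k τ → Interlacing τ →
                           InOrbit τ σ → Interlacing σ → σ ≡ τ
interlacing-orbit-unique τ σ (τ-injective , _) τ-interlacing orbit σ-interlacing =
  let (w , σ≡) = orbit⊆reorientations orbit in
  trans σ≡ (reorient-unreversed (interlacing⇒unreversed w τ-interlacing (subst Interlacing σ≡ σ-interlacing)))
  where open Reorientation τ τ-injective
        open InterlacedReorientation τ τ-injective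

lemma9 : (n k : ℕ) → 1 ≤ k → k ≤ n →
  ((τ : Matching n) → IsMatching k τ →
    Σ (List (Matching n)) λ xs →
      Unique xs × ((σ : Matching n) → (σ ∈ xs ⇔ InOrbit τ σ)) × length xs ≡ 2 ^ p k τ)
  ×
  ((τ σ : Matching n) → IsMatching k τ → Interlacing τ →
    InOrbit τ σ → Interlacing σ → σ ≡ τ)
lemma9 n k _ _ = orbit-enumeration k , λ τ σ → interlacing-orbit-unique τ σ
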